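{- Let $n\ge1$ and $0\le j\le\lfloor n/2\rfloor$. The set of lattice paths from $(0,0)$ to $(\lceil n/2\rceil,\lfloor n/2\rfloor)$ with $\mathsf N,\mathsf E$ steps that pass through the points $(0,j)$ and $(1,j)$ is in one-to-one correspondence with the set of permutations $\sigma\in\mathcal{I}_n(321)$ with $\mathrm{lead}(\sigma)=j+1$.
   Context: $\mathcal{I}_n(321)$ is the set of involutions $\sigma=\sigma_1\cdots\sigma_n$ of $\{1,\dots,n\}$ with no decreasing subsequence of length three, and $\mathrm{lead}(\sigma)=\sigma_1$. Lattice paths use north steps $\mathsf N=(0,1)$ and east steps $\mathsf E=(1,0)$. -}

module Defs where

open import Data.Nat using (ℕ; zero; suc; _+_; _<_; ⌊_/2⌋; ⌈_/2⌉)
open import Data.Fin using (Fin; toℕ) renaming (zero to fzero; _<_ to _<ᶠ_)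
open import Data.Vec using (Vec; lookup)
open import Data.List using (List; []; _∷_; take)
open import Data.Product using (_×_; _,_; ∃; ∃-syntax)
open import Relation.Binary.PropositionalEquality using (_≡_)
open import Relation.Nullary using (¬_)

data Step : Set where
  N E : Step

endpoint : List Step → ℕ × ℕ
endpoint [] = 0 , 0
endpoint (N ∷ s) with endpoint s
... | x , y = x , suc y
endpoint (E ∷ s) with endpoint s
... | x , y = suc x , y

PassesThrough : List Step → ℕ × ℕ → Set
PassesThrough s pt = ∃[ k ] endpoint (take k s) ≡ pt

-- Lattice paths from (0,0) to (a,b) passing through (0,j) and (1,j).
-- Proof fields are irrelevant, so two such paths are equal iff their step lists are.
record PathThrough (a b j : ℕ) : Set where
  constructor mkPath
  field
    steps : List Step
    .ends : endpoint steps ≡ (a , b)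
    .through0 : PassesThrough steps (0 , j)
    .through1 : PassesThrough steps (1 , j)

-- A permutation word σ = σ₁⋯σₙ of {1,…,n}, encoded 0-indexed:
-- position i : Fin n holds the value lookup σ i (value k : Fin n stands for k+1).
IsInvolution : ∀ {n} → Vec (Fin n) n → Set
IsInvolution σ = ∀ i → lookup σ (lookup σ i) ≡ i

Avoids321 : ∀ {n} → Vec (Fin n) n → Set
Avoids321 σ = ¬ (∃[ i ] ∃[ j ] ∃[ k ]
  (i <ᶠ j × j <ᶠ k × lookup σ k <ᶠ lookup σ j × lookup σ j <ᶠ lookup σ i))

lead : ∀ {m} → Vec (Fin (suc m)) (suc m) → ℕ
lead σ = suc (toℕ (lookup σ fzero))

record Inv321Lead (m l : ℕ) : Set where
  constructor mkInv
  field
    word : Vec (Fin (suc m)) (suc m)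
    .invol : IsInvolution word
    .avoid : Avoids321 word
    .leadEq : lead word ≡ l

module Submission where

-- A lattice path from (0,0) to (⌈n/2⌉, ⌊n/2⌋) is read step by step against its distance
-- from the diagonal (ending on or next to it), which turns it into a word of length n in the
-- letters U, D, F: a Motzkin path whose flat steps F lie on the axis.  These words are the arc
-- diagrams of the 321-avoiding involutions of {1,…,n}: U opens an arc, D closes the oldest
-- open one and F is a fixed point.  A path through (0,j) and (1,j) starts with N^j E, which
-- becomes the prefix U^j D of its word (F if j = 0), and that prefix says exactly that 1 is
-- joined to j+1, i.e. lead(σ) = j+1.

open import Defs
open import Data.Nat.Base using (ℕ; zero; suc; pred; _+_; _∸_; _≤_; _<_; _≤′_; ≤′-refl; ≤′-step; z≤n; s≤s; z<s; ⌊_/2⌋; ⌈_/2⌉)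
open import Data.Nat.Properties
open import Algebra.Properties.CommutativeSemigroup +-commutativeSemigroup using (x∙yz≈y∙xz)
open import Data.Bool.Base using (Bool; true; false)
open import Data.Empty using (⊥; ⊥-elim)
open import Data.Fin.Base using (Fin; toℕ; fromℕ<) renaming (zero to fzero)
open import Data.Fin.Properties using (toℕ<n; toℕ-fromℕ<; fromℕ<-toℕ; toℕ-injective) renaming (_≟_ to _≟ᶠ_)
open import Data.List.Base using (List; []; _∷_; length; replicate; _++_; take; drop; applyUpTo)
open import Data.List.Properties using (≡-dec; ++-assoc; length-++; length-++-≤ˡ; length-applyUpTo; length-drop)
open import Data.Product.Base using (∃-syntax; _×_; _,_; proj₁; proj₂; map₁; map₂)
open import Data.Sum.Base using (_⊎_; inj₁; inj₂)
import Data.Sum.Base as Sum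
open import Data.Vec.Base using (Vec; lookup; tabulate)
open import Data.Vec.Properties using (lookup∘tabulate; tabulate∘lookup; tabulate-cong) renaming (≡-dec to ≡-decᵛ)
open import Function.Base using (_∘_; id)
open import Function.Bundles using (_↔_; mk↔ₛ′)
open import Function.Properties.Inverse using (↔-trans)
open import Relation.Binary.Definitions using (DecidableEquality; Tri; tri<; tri≈; tri>)
open import Relation.Binary.PropositionalEquality
open import Relation.Nullary using (Dec; yes; no; ¬_; contradiction)
open import Relation.Nullary.Decidable using (¬?; _×-dec_; recompute)
open import Relation.Unary using (Decidable)

-- Counting below a bound

χ : ∀ {a} {A : Set a} → Dec A → ℕ
χ (yes _) = 1
χ (no _)  = 0

χ-cong : ∀ {a b} {A : Set a} {B : Set b} → (A → B) → (B → A) →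
         (a? : Dec A) (b? : Dec B) → χ a? ≡ χ b?
χ-cong f g (yes _) (yes _) = refl
χ-cong f g (yes a) (no ¬b) = contradiction (f a) ¬b
χ-cong f g (no ¬a) (yes b) = contradiction (g b) ¬a
χ-cong f g (no _)  (no _)  = refl

χ-yes : ∀ {a} {A : Set a} → A → (a? : Dec A) → χ a? ≡ 1
χ-yes a a? = χ-cong (λ _ → a) (λ _ → a) a? (yes a)

χ-no : ∀ {a} {A : Set a} → ¬ A → (a? : Dec A) → χ a? ≡ 0
χ-no ¬a a? = χ-cong ¬a (λ ()) a? (no λ ())

module _ {p} {P : ℕ → Set p} (P? : Decidable P) where

  count : ℕ → ℕ
  count zero    = 0
  count (suc i) = χ (P? i) + count i

  count-yes : ∀ {i} → P i → count (suc i) ≡ suc (count i)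
  count-yes {i} Pi = cong (_+ count i) (χ-yes Pi (P? i))

  count-none : ∀ {i} → (∀ {k} → k < i → ¬ P k) → count i ≡ 0
  count-none {zero}  none = refl
  count-none {suc i} none = cong₂ _+_ (χ-no (none ≤-refl) (P? i)) (count-none (none ∘ m<n⇒m<1+n))

  count-mono : ∀ {i k} → i ≤ k → count i ≤ count k
  count-mono = mono′ ∘ ≤⇒≤′
    where
    mono′ : ∀ {i k} → i ≤′ k → count i ≤ count k
    mono′ ≤′-refl        = ≤-refl
    mono′ (≤′-step i≤′k) = ≤-trans (mono′ i≤′k) (m≤n+m _ _)

  count-< : ∀ {i k} → i < k → P i → count i < count k
  count-< i<k Pi = ≤-trans (≤-reflexive (sym (count-yes Pi))) (count-mono i<k)

  count-cancel-< : ∀ {i k} → count i < count k → i < k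
  count-cancel-< {i} {k} lt with i <? k
  ... | yes i<k = i<k
  ... | no i≮k  = contradiction (count-mono (≮⇒≥ i≮k)) (<⇒≱ lt)

  count-injective : ∀ {i k} → P i → P k → count i ≡ count k → i ≡ k
  count-injective {i} {k} Pi Pk eq with <-cmp i k
  ... | tri< i<k _ _ = contradiction eq (<⇒≢ (count-< i<k Pi))
  ... | tri≈ _ i≡k _ = i≡k
  ... | tri> _ _ k<i = contradiction (sym eq) (<⇒≢ (count-< k<i Pk))

  count-intermediate : ∀ {c} k → c < count k → ∃[ j ] (j < k × P j × count j ≡ c)
  count-intermediate {c} (suc k) lt with c <? count k | P? k
  ... | yes c<k | _ with count-intermediate k c<k
  ...   | j , j<k , Pj , eq = j , m<n⇒m<1+n j<k , Pj , eq
  count-intermediate {c} (suc k) lt | no c≮k | yes Pk = k , ≤-refl , Pk , ≤-antisym (≮⇒≥ c≮k) (≤-pred lt)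
  count-intermediate {c} (suc k) lt | no c≮k | no _   = contradiction lt c≮k

  find : ℕ → ℕ
  find zero = zero
  find (suc k) with P? k
  ... | yes _ = k
  ... | no _  = find k

  find-unique : ∀ {j k} → j < k → P j → (∀ {j′} → P j′ → j′ ≡ j) → find k ≡ j
  find-unique {j} {suc k} j<1+k Pj unique with P? k
  ... | yes Pk = unique Pk
  ... | no ¬Pk = find-unique (≤∧≢⇒< (≤-pred j<1+k) (λ { refl → ¬Pk Pj })) Pj unique

count-shift : ∀ {p} {P : ℕ → Set p} (P? : Decidable P) i →
              count P? (suc i) ≡ χ (P? 0) + count (P? ∘ suc) i
count-shift P? zero    = refl
count-shift P? (suc i) = begin
  χ (P? (suc i)) + count P? (suc i)                  ≡⟨ cong (χ (P? (suc i)) +_) (count-shift P? i) ⟩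
  χ (P? (suc i)) + (χ (P? 0) + count (P? ∘ suc) i)    ≡⟨ x∙yz≈y∙xz (χ (P? (suc i))) (χ (P? 0)) (count (P? ∘ suc) i) ⟩
  χ (P? 0) + count (P? ∘ suc) (suc i)                ∎
  where open ≡-Reasoning

count-cong : ∀ {p q} {P : ℕ → Set p} {Q : ℕ → Set q} (P? : Decidable P) (Q? : Decidable Q) {i} →
             (∀ {k} → k < i → P k → Q k) → (∀ {k} → k < i → Q k → P k) →
             count P? i ≡ count Q? i
count-cong P? Q? {zero}  f g = refl
count-cong P? Q? {suc i} f g =
  cong₂ _+_ (χ-cong (f ≤-refl) (g ≤-refl) (P? i) (Q? i))
            (count-cong P? Q? (f ∘ m<n⇒m<1+n) (g ∘ m<n⇒m<1+n))

find-cong : ∀ {p q} {P : ℕ → Set p} {Q : ℕ → Set q} (P? : Decidable P) (Q? : Decidable Q) {n} →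
            (∀ {k} → k < n → P k → Q k) → (∀ {k} → k < n → Q k → P k) → find P? n ≡ find Q? n
find-cong P? Q? {zero}  f g = refl
find-cong P? Q? {suc n} f g with P? n | Q? n
... | yes _  | yes _  = refl
... | no _   | no _   = find-cong P? Q? (f ∘ m<n⇒m<1+n) (g ∘ m<n⇒m<1+n)
... | yes Pn | no ¬Qn = contradiction (f ≤-refl Pn) ¬Qn
... | no ¬Pn | yes Qn = contradiction (g ≤-refl Qn) ¬Pn

_∖_ : ∀ {q} {Q : ℕ → Set q} → Decidable Q → (y : ℕ) → Decidable (λ z → Q z × z ≢ y)
(Q? ∖ y) z = Q? z ×-dec ¬? (z ≟ y)

count-∖ : ∀ {q} {Q : ℕ → Set q} (Q? : Decidable Q) {y k} → y < k → Q y → count Q? k ≡ suc (count (Q? ∖ y) k)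
count-∖ Q? {y} {suc k} y<1+k Qy with y ≟ k
... | yes refl = cong₂ _+_ (χ-yes Qy (Q? y)) (begin
  count Q? y                             ≡⟨ count-cong Q? (Q? ∖ y) (λ z<y Qz → Qz , <⇒≢ z<y) (λ _ → proj₁) ⟩
  count (Q? ∖ y) y                       ≡⟨ cong (_+ count (Q? ∖ y) y) (χ-no (λ (_ , y≢y) → y≢y refl) ((Q? ∖ y) y)) ⟨
  χ ((Q? ∖ y) y) + count (Q? ∖ y) y      ∎)
  where open ≡-Reasoning
... | no y≢k = begin
  χ (Q? k) + count Q? k                  ≡⟨ cong₂ _+_ (χ-cong (_, y≢k ∘ sym) proj₁ (Q? k) ((Q? ∖ y) k))
                                                     (count-∖ Q? (≤∧≢⇒< (≤-pred y<1+k) y≢k) Qy) ⟩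
  χ ((Q? ∖ y) k) + suc (count (Q? ∖ y) k) ≡⟨ +-suc (χ ((Q? ∖ y) k)) _ ⟩
  suc (χ ((Q? ∖ y) k) + count (Q? ∖ y) k) ∎
  where open ≡-Reasoning

count-≤-injection : ∀ {p q} {P : ℕ → Set p} {Q : ℕ → Set q} (P? : Decidable P) (Q? : Decidable Q)
                    {n k} (f : ℕ → ℕ) →
                    (∀ {x} → x < n → P x → f x < k × Q (f x)) →
                    (∀ {x y} → x < n → y < n → P x → P y → f x ≡ f y → x ≡ y) →
                    count P? n ≤ count Q? k
count-≤-injection P? Q? {zero}  f into inj = z≤n
count-≤-injection {P = P} {Q} P? Q? {suc n} {k} f into inj with P? n
... | no _ = count-≤-injection P? Q? f (into ∘ m<n⇒m<1+n)
               (λ x<n y<n → inj (m<n⇒m<1+n x<n) (m<n⇒m<1+n y<n))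
... | yes Pn = begin
  suc (count P? n)                       ≤⟨ s≤s (count-≤-injection P? (Q? ∖ f n) f into′ inj′) ⟩
  suc (count (Q? ∖ f n) k)               ≡⟨ count-∖ Q? (proj₁ (into ≤-refl Pn)) (proj₂ (into ≤-refl Pn)) ⟨
  count Q? k                             ∎
  where
  open ≤-Reasoning
  into′ : ∀ {x} → x < n → P x → f x < k × (Q (f x) × f x ≢ f n)
  into′ x<n Px = proj₁ (into (m<n⇒m<1+n x<n) Px)
               , proj₂ (into (m<n⇒m<1+n x<n) Px) , <⇒≢ x<n ∘ inj (m<n⇒m<1+n x<n) ≤-refl Px Pn
  inj′ : ∀ {x y} → x < n → y < n → P x → P y → f x ≡ f y → x ≡ y
  inj′ x<n y<n = inj (m<n⇒m<1+n x<n) (m<n⇒m<1+n y<n)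

data Letter : Set where
  U D F : Letter

_≟ₗ_ : DecidableEquality Letter
U ≟ₗ U = yes refl
U ≟ₗ D = no λ ()
U ≟ₗ F = no λ ()
D ≟ₗ U = no λ ()
D ≟ₗ D = yes refl
D ≟ₗ F = no λ ()
F ≟ₗ U = no λ ()
F ≟ₗ D = no λ ()
F ≟ₗ F = yes refl

letter-cases : ∀ {p} {P : Set p} (x : Letter) → (x ≡ U → P) → (x ≡ D → P) → (x ≡ F → P) → P
letter-cases U u d f = u refl
letter-cases D u d f = d refl
letter-cases F u d f = f refl

Valid : ℕ → List Letter → Set
Valid h       []      = h ≡ 0
Valid h       (U ∷ w) = Valid (suc h) w
Valid zero    (D ∷ w) = ⊥
Valid (suc h) (D ∷ w) = Valid h w
Valid zero    (F ∷ w) = Valid zero w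
Valid (suc h) (F ∷ w) = ⊥

at : List Letter → ℕ → Letter
at []      i       = F
at (x ∷ w) zero    = x
at (x ∷ w) (suc i) = at w i

ups downs : (ℕ → Letter) → ℕ → ℕ
ups   W = count (λ k → W k ≟ₗ U)
downs W = count (λ k → W k ≟ₗ D)

record Ballot (W : ℕ → Letter) (up down : ℕ → ℕ) (n : ℕ) : Set where
  field
    down< : ∀ {i} → i < n → W i ≡ D → down i < up i
    flat≡ : ∀ {i} → i < n → W i ≡ F → up i ≡ down i
    closed : up n ≡ down n
open Ballot

ValidCounts : ℕ → (ℕ → Letter) → ℕ → Set
ValidCounts h W = Ballot W (λ i → h + ups W i) (downs W)

module _ {W : ℕ → Letter} {up down up′ down′ : ℕ → ℕ} {n : ℕ} (c : ℕ)
         (up-suc : ∀ i → up (suc i) ≡ c + up′ i) (down-suc : ∀ i → down (suc i) ≡ c + down′ i) where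

  Ballot-tail : Ballot W up down (suc n) → Ballot (W ∘ suc) up′ down′ n
  Ballot-tail b = record
    { down< = λ i<n Wi → +-cancelˡ-< c _ _ (subst₂ _<_ (down-suc _) (up-suc _) (down< b (s≤s i<n) Wi))
    ; flat≡ = λ i<n Wi → +-cancelˡ-≡ c _ _ (trans (sym (up-suc _)) (trans (flat≡ b (s≤s i<n) Wi) (down-suc _)))
    ; closed = +-cancelˡ-≡ c _ _ (trans (sym (up-suc n)) (trans (closed b) (down-suc n)))
    }

  Ballot-cons : (W 0 ≡ D → down 0 < up 0) → (W 0 ≡ F → up 0 ≡ down 0) →
                Ballot (W ∘ suc) up′ down′ n → Ballot W up down (suc n)
  Ballot-cons head-down head-flat b = record { down< = down<′ ; flat≡ = flat≡′ ; closed = closed′ }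
    where
    down<′ : ∀ {i} → i < suc n → W i ≡ D → down i < up i
    down<′ {zero}  _         = head-down
    down<′ {suc i} (s≤s i<n) Wi = subst₂ _<_ (sym (down-suc i)) (sym (up-suc i)) (+-monoʳ-< c (down< b i<n Wi))
    flat≡′ : ∀ {i} → i < suc n → W i ≡ F → up i ≡ down i
    flat≡′ {zero}  _         = head-flat
    flat≡′ {suc i} (s≤s i<n) Wi = trans (up-suc i) (trans (cong (c +_) (flat≡ b i<n Wi)) (sym (down-suc i)))
    closed′ : up (suc n) ≡ down (suc n)
    closed′ = trans (up-suc n) (trans (cong (c +_) (closed b)) (sym (down-suc n)))

ups-∷ : ∀ x w i → ups (at (x ∷ w)) (suc i) ≡ χ (x ≟ₗ U) + ups (at w) i
ups-∷ x w = count-shift (λ k → at (x ∷ w) k ≟ₗ U)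

downs-∷ : ∀ x w i → downs (at (x ∷ w)) (suc i) ≡ χ (x ≟ₗ D) + downs (at w) i
downs-∷ x w = count-shift (λ k → at (x ∷ w) k ≟ₗ D)

height-∷ : ∀ h x w i → h + ups (at (x ∷ w)) (suc i) ≡ h + (χ (x ≟ₗ U) + ups (at w) i)
height-∷ h x w i = cong (h +_) (ups-∷ x w i)

height-U∷ : ∀ h w i → h + ups (at (U ∷ w)) (suc i) ≡ suc h + ups (at w) i
height-U∷ h w i = trans (height-∷ h U w i) (+-suc h _)

Valid⇒ValidCounts : ∀ h w → Valid h w → ValidCounts h (at w) (length w)
Valid⇒ValidCounts h       []      refl = record { down< = λ () ; flat≡ = λ () ; closed = refl }
Valid⇒ValidCounts h       (U ∷ w) v    =
  Ballot-cons 0 (height-U∷ h w) (downs-∷ U w) (λ ()) (λ ()) (Valid⇒ValidCounts (suc h) w v)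
Valid⇒ValidCounts (suc h) (D ∷ w) v    =
  Ballot-cons 1 (height-∷ (suc h) D w) (downs-∷ D w) (λ _ → s≤s z≤n) (λ ()) (Valid⇒ValidCounts h w v)
Valid⇒ValidCounts zero    (F ∷ w) v    =
  Ballot-cons 0 (ups-∷ F w) (downs-∷ F w) (λ ()) (λ _ → refl) (Valid⇒ValidCounts zero w v)

ValidCounts⇒Valid : ∀ h w → ValidCounts h (at w) (length w) → Valid h w
ValidCounts⇒Valid h       []      b = m+n≡0⇒m≡0 h (closed b)
ValidCounts⇒Valid h       (U ∷ w) b = ValidCounts⇒Valid (suc h) w (Ballot-tail 0 (height-U∷ h w) (downs-∷ U w) b)
ValidCounts⇒Valid zero    (D ∷ w) b = contradiction (down< b (s≤s z≤n) refl) λ ()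
ValidCounts⇒Valid (suc h) (D ∷ w) b = ValidCounts⇒Valid h w (Ballot-tail 1 (height-∷ (suc h) D w) (downs-∷ D w) b)
ValidCounts⇒Valid zero    (F ∷ w) b = ValidCounts⇒Valid zero w (Ballot-tail 0 (ups-∷ F w) (downs-∷ F w) b)
ValidCounts⇒Valid (suc h) (F ∷ w) b = contradiction (flat≡ b (s≤s z≤n) refl) λ ()

at-++ˡ : ∀ p t {i} → i < length p → at (p ++ t) i ≡ at p i
at-++ˡ (x ∷ p) t {zero}  _   = refl
at-++ˡ (x ∷ p) t {suc i} i<p = at-++ˡ p t (≤-pred i<p)

drop-++ : ∀ (p t : List Letter) → drop (length p) (p ++ t) ≡ t
drop-++ []      t = refl
drop-++ (x ∷ p) t = drop-++ p t

++-drop : ∀ p w → length p ≤ length w → (∀ {i} → i < length p → at w i ≡ at p i) → w ≡ p ++ drop (length p) w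
++-drop []      w       _   _    = refl
++-drop (x ∷ p) (y ∷ w) p≤w same = cong₂ _∷_ (same z<s) (++-drop p w (≤-pred p≤w) (same ∘ s≤s))

at-applyUpTo : ∀ f {n i} → i < n → at (applyUpTo f n) i ≡ f i
at-applyUpTo f {suc n} {zero}  _   = refl
at-applyUpTo f {suc n} {suc i} i<n = at-applyUpTo (f ∘ suc) (≤-pred i<n)

applyUpTo-at : ∀ w → applyUpTo (at w) (length w) ≡ w
applyUpTo-at []      = refl
applyUpTo-at (x ∷ w) = cong (x ∷_) (applyUpTo-at w)

applyUpTo-cong : ∀ {f g : ℕ → Letter} {n} → (∀ {i} → i < n → f i ≡ g i) → applyUpTo f n ≡ applyUpTo g n
applyUpTo-cong {n = zero}  same = refl
applyUpTo-cong {n = suc n} same = cong₂ _∷_ (same z<s) (applyUpTo-cong (same ∘ s≤s))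

-- Lattice paths as words

bit : Bool → ℕ
bit false = 0
bit true  = 1

-- Translating a path into a word, the state (h, p, s) says that the displacement (x , y)
-- still to be travelled is off the diagonal by h + bit p, on the side of x iff s = true.
-- A step away from the diagonal is U and one towards it is D, except that a step between
-- offsets 0 and 1 is F when it toggles p; so h is the height of the word.
Gap : ℕ → Bool → Bool → ℕ × ℕ → Set
Gap h p true  (x , y) = x ≡ (h + bit p) + y
Gap h p false (x , y) = y ≡ (h + bit p) + x

pathWord : ℕ → Bool → Bool → List Step → List Letter
pathWord h       p     s     []      = []
pathWord zero    false s     (N ∷ π) = U ∷ pathWord 1 false true π
pathWord zero    false s     (E ∷ π) = F ∷ pathWord 0 true false π
pathWord zero    true  true  (N ∷ π) = U ∷ pathWord 1 true true π
pathWord zero    true  true  (E ∷ π) = F ∷ pathWord 0 false true π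
pathWord zero    true  false (E ∷ π) = U ∷ pathWord 1 true false π
pathWord zero    true  false (N ∷ π) = F ∷ pathWord 0 false false π
pathWord (suc h) p     true  (N ∷ π) = U ∷ pathWord (suc (suc h)) p true π
pathWord (suc h) p     true  (E ∷ π) = D ∷ pathWord h p true π
pathWord (suc h) p     false (E ∷ π) = U ∷ pathWord (suc (suc h)) p false π
pathWord (suc h) p     false (N ∷ π) = D ∷ pathWord h p false π

wordPath : ℕ → Bool → Bool → List Letter → List Step
wordPath h       p     s     []      = []
wordPath zero    false s     (U ∷ t) = N ∷ wordPath 1 false true t
wordPath zero    false s     (F ∷ t) = E ∷ wordPath 0 true false t
wordPath zero    true  true  (U ∷ t) = N ∷ wordPath 1 true true t
wordPath zero    true  true  (F ∷ t) = E ∷ wordPath 0 false true t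
wordPath zero    true  false (U ∷ t) = E ∷ wordPath 1 true false t
wordPath zero    true  false (F ∷ t) = N ∷ wordPath 0 false false t
wordPath (suc h) p     true  (U ∷ t) = N ∷ wordPath (suc (suc h)) p true t
wordPath (suc h) p     true  (D ∷ t) = E ∷ wordPath h p true t
wordPath (suc h) p     false (U ∷ t) = E ∷ wordPath (suc (suc h)) p false t
wordPath (suc h) p     false (D ∷ t) = N ∷ wordPath h p false t
wordPath zero    p     s     (D ∷ t) = []
wordPath (suc h) p     s     (F ∷ t) = []

wordPath-pathWord : ∀ h p s π → wordPath h p s (pathWord h p s π) ≡ π
wordPath-pathWord h       p     s     []      = refl
wordPath-pathWord zero    false s     (N ∷ π) = cong (N ∷_) (wordPath-pathWord 1 false true π)
wordPath-pathWord zero    false s     (E ∷ π) = cong (E ∷_) (wordPath-pathWord 0 true false π)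
wordPath-pathWord zero    true  true  (N ∷ π) = cong (N ∷_) (wordPath-pathWord 1 true true π)
wordPath-pathWord zero    true  true  (E ∷ π) = cong (E ∷_) (wordPath-pathWord 0 false true π)
wordPath-pathWord zero    true  false (E ∷ π) = cong (E ∷_) (wordPath-pathWord 1 true false π)
wordPath-pathWord zero    true  false (N ∷ π) = cong (N ∷_) (wordPath-pathWord 0 false false π)
wordPath-pathWord (suc h) p     true  (N ∷ π) = cong (N ∷_) (wordPath-pathWord (suc (suc h)) p true π)
wordPath-pathWord (suc h) p     true  (E ∷ π) = cong (E ∷_) (wordPath-pathWord h p true π)
wordPath-pathWord (suc h) p     false (E ∷ π) = cong (E ∷_) (wordPath-pathWord (suc (suc h)) p false π)
wordPath-pathWord (suc h) p     false (N ∷ π) = cong (N ∷_) (wordPath-pathWord h p false π)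

pathWord-wordPath : ∀ h p s t → Valid h t → pathWord h p s (wordPath h p s t) ≡ t
pathWord-wordPath h       p     s     []      v = refl
pathWord-wordPath zero    false s     (U ∷ t) v = cong (U ∷_) (pathWord-wordPath 1 false true t v)
pathWord-wordPath zero    false s     (F ∷ t) v = cong (F ∷_) (pathWord-wordPath 0 true false t v)
pathWord-wordPath zero    true  true  (U ∷ t) v = cong (U ∷_) (pathWord-wordPath 1 true true t v)
pathWord-wordPath zero    true  true  (F ∷ t) v = cong (F ∷_) (pathWord-wordPath 0 false true t v)
pathWord-wordPath zero    true  false (U ∷ t) v = cong (U ∷_) (pathWord-wordPath 1 true false t v)
pathWord-wordPath zero    true  false (F ∷ t) v = cong (F ∷_) (pathWord-wordPath 0 false false t v)
pathWord-wordPath (suc h) p     true  (U ∷ t) v = cong (U ∷_) (pathWord-wordPath (suc (suc h)) p true t v)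
pathWord-wordPath (suc h) p     true  (D ∷ t) v = cong (D ∷_) (pathWord-wordPath h p true t v)
pathWord-wordPath (suc h) p     false (U ∷ t) v = cong (U ∷_) (pathWord-wordPath (suc (suc h)) p false t v)
pathWord-wordPath (suc h) p     false (D ∷ t) v = cong (D ∷_) (pathWord-wordPath h p false t v)

length-pathWord : ∀ h p s π → length (pathWord h p s π) ≡ length π
length-pathWord h       p     s     []      = refl
length-pathWord zero    false s     (N ∷ π) = cong suc (length-pathWord 1 false true π)
length-pathWord zero    false s     (E ∷ π) = cong suc (length-pathWord 0 true false π)
length-pathWord zero    true  true  (N ∷ π) = cong suc (length-pathWord 1 true true π)
length-pathWord zero    true  true  (E ∷ π) = cong suc (length-pathWord 0 false true π)
length-pathWord zero    true  false (E ∷ π) = cong suc (length-pathWord 1 true false π)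
length-pathWord zero    true  false (N ∷ π) = cong suc (length-pathWord 0 false false π)
length-pathWord (suc h) p     true  (N ∷ π) = cong suc (length-pathWord (suc (suc h)) p true π)
length-pathWord (suc h) p     true  (E ∷ π) = cong suc (length-pathWord h p true π)
length-pathWord (suc h) p     false (E ∷ π) = cong suc (length-pathWord (suc (suc h)) p false π)
length-pathWord (suc h) p     false (N ∷ π) = cong suc (length-pathWord h p false π)

pathWord-valid : ∀ h p s π → Gap h p s (endpoint π) → Valid h (pathWord h p s π)
pathWord-valid h       p     true  []      e = m+n≡0⇒m≡0 h (m+n≡0⇒m≡0 _ (sym e))
pathWord-valid h       p     false []      e = m+n≡0⇒m≡0 h (m+n≡0⇒m≡0 _ (sym e))
pathWord-valid zero    false true  (N ∷ π) e = pathWord-valid 1 false true π e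
pathWord-valid zero    false false (N ∷ π) e = pathWord-valid 1 false true π (sym e)
pathWord-valid zero    false true  (E ∷ π) e = pathWord-valid 0 true false π (sym e)
pathWord-valid zero    false false (E ∷ π) e = pathWord-valid 0 true false π e
pathWord-valid zero    true  true  (N ∷ π) e = pathWord-valid 1 true true π e
pathWord-valid zero    true  true  (E ∷ π) e = pathWord-valid 0 false true π (suc-injective e)
pathWord-valid zero    true  false (E ∷ π) e = pathWord-valid 1 true false π e
pathWord-valid zero    true  false (N ∷ π) e = pathWord-valid 0 false false π (suc-injective e)
pathWord-valid (suc h) p     true  (N ∷ π) e = pathWord-valid (suc (suc h)) p true π (trans e (+-suc (suc h + bit p) _))
pathWord-valid (suc h) p     true  (E ∷ π) e = pathWord-valid h p true π (suc-injective e)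
pathWord-valid (suc h) p     false (E ∷ π) e = pathWord-valid (suc (suc h)) p false π (trans e (+-suc (suc h + bit p) _))
pathWord-valid (suc h) p     false (N ∷ π) e = pathWord-valid h p false π (suc-injective e)

Valid-length : ∀ h t → Valid h t → h ≤ length t
Valid-length h       []      refl = z≤n
Valid-length h       (U ∷ t) v    = m<n⇒m≤1+n (Valid-length (suc h) t v)
Valid-length (suc h) (D ∷ t) v    = s≤s (Valid-length h t v)
Valid-length zero    (F ∷ t) v    = z≤n

Valid-too-short : ∀ k p t → Valid (suc k) t → suc (length t) ≢ (k + bit p) + 0
Valid-too-short k p t v eq = <⇒≱ (k+bit<2+k p) (begin
  suc (suc k)         ≤⟨ s≤s (Valid-length (suc k) t v) ⟩
  suc (length t)      ≡⟨ trans eq (+-identityʳ _) ⟩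
  k + bit p           ∎)
  where
  open ≤-Reasoning
  k+bit<2+k : ∀ p → k + bit p < suc (suc k)
  k+bit<2+k false = s≤s (≤-trans (≤-reflexive (+-identityʳ k)) (n≤1+n k))
  k+bit<2+k true  = ≤-reflexive (cong suc (+-comm k 1))

suc≡+suc⇒≡+ : ∀ {l} x y → suc l ≡ x + suc y → l ≡ x + y
suc≡+suc⇒≡+ x y len = suc-injective (trans len (+-suc x y))

wordPath-endpoint : ∀ h p s t {x y} → Valid h t → Gap h p s (x , y) → length t ≡ x + y →
                    endpoint (wordPath h p s t) ≡ (x , y)
wordPath-endpoint h       p     s     []      {zero}  {zero}  v e len = refl
wordPath-endpoint zero    false true  (U ∷ t)         {zero}  v refl ()
wordPath-endpoint zero    false false (U ∷ t)         {zero}  v refl ()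
wordPath-endpoint zero    false true  (U ∷ t) {x}     {suc y} v e len =
  cong (map₂ suc) (wordPath-endpoint 1 false true t v e (suc≡+suc⇒≡+ x y len))
wordPath-endpoint zero    false false (U ∷ t) {x}     {suc y} v e len =
  cong (map₂ suc) (wordPath-endpoint 1 false true t v (sym e) (suc≡+suc⇒≡+ x y len))
wordPath-endpoint zero    false true  (F ∷ t) {zero}          v refl ()
wordPath-endpoint zero    false false (F ∷ t) {zero}          v refl ()
wordPath-endpoint zero    false true  (F ∷ t) {suc x}         v e len =
  cong (map₁ suc) (wordPath-endpoint 0 true false t v (sym e) (suc-injective len))
wordPath-endpoint zero    false false (F ∷ t) {suc x}         v e len =
  cong (map₁ suc) (wordPath-endpoint 0 true false t v e (suc-injective len))
wordPath-endpoint zero    true  true  (U ∷ t) {x}     {zero}  v e len =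
  ⊥-elim (Valid-too-short 0 true t v (trans len (trans (+-identityʳ x) e)))
wordPath-endpoint zero    true  true  (U ∷ t) {x}     {suc y} v e len =
  cong (map₂ suc) (wordPath-endpoint 1 true true t v e (suc≡+suc⇒≡+ x y len))
wordPath-endpoint zero    true  true  (F ∷ t)                 v refl len =
  cong (map₁ suc) (wordPath-endpoint 0 false true t v refl (suc-injective len))
wordPath-endpoint zero    true  false (U ∷ t) {zero}          v e len =
  ⊥-elim (Valid-too-short 0 true t v (trans len e))
wordPath-endpoint zero    true  false (U ∷ t) {suc x}         v e len =
  cong (map₁ suc) (wordPath-endpoint 1 true false t v e (suc-injective len))
wordPath-endpoint zero    true  false (F ∷ t) {x}             v refl len =
  cong (map₂ suc) (wordPath-endpoint 0 false false t v refl (suc≡+suc⇒≡+ x x len))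
wordPath-endpoint (suc h) p     true  (U ∷ t) {x}     {zero}  v e len =
  ⊥-elim (Valid-too-short (suc h) p t v (trans len (trans (+-identityʳ x) e)))
wordPath-endpoint (suc h) p     true  (U ∷ t) {x}     {suc y} v e len =
  cong (map₂ suc) (wordPath-endpoint (suc (suc h)) p true t v (trans e (+-suc (suc h + bit p) y)) (suc≡+suc⇒≡+ x y len))
wordPath-endpoint (suc h) p     true  (D ∷ t)                 v refl len =
  cong (map₁ suc) (wordPath-endpoint h p true t v refl (suc-injective len))
wordPath-endpoint (suc h) p     false (U ∷ t) {zero}          v e len =
  ⊥-elim (Valid-too-short (suc h) p t v (trans len e))
wordPath-endpoint (suc h) p     false (U ∷ t) {suc x}         v e len =
  cong (map₁ suc) (wordPath-endpoint (suc (suc h)) p false t v (trans e (+-suc (suc h + bit p) x)) (suc-injective len))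
wordPath-endpoint (suc h) p     false (D ∷ t) {x}             v refl len =
  cong (map₂ suc) (wordPath-endpoint h p false t v refl (suc≡+suc⇒≡+ x _ len))

record PathTo (x y : ℕ) : Set where
  constructor path
  field
    steps : List Step
    .ends : endpoint steps ≡ (x , y)

record ValidWord (h n : ℕ) : Set where
  constructor word
  field
    letters : List Letter
    .valid : Valid h letters
    .length≡ : length letters ≡ n

path-cong : ∀ {x y π π′} .{e e′} → π ≡ π′ → path {x} {y} π e ≡ path π′ e′
path-cong refl = refl

word-cong : ∀ {h n t t′} .{v v′ l l′} → t ≡ t′ → word {h} {n} t v l ≡ word t′ v′ l′
word-cong refl = refl

_≟ₛ_ : DecidableEquality Step
N ≟ₛ N = yes refl
N ≟ₛ E = no λ ()
E ≟ₛ N = no λ ()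
E ≟ₛ E = yes refl

length-endpoint : ∀ π → length π ≡ proj₁ (endpoint π) + proj₂ (endpoint π)
length-endpoint []      = refl
length-endpoint (N ∷ π) = trans (cong suc (length-endpoint π)) (sym (+-suc _ _))
length-endpoint (E ∷ π) = cong suc (length-endpoint π)

paths↔validWords : ∀ {h p s x y} → Gap h p s (x , y) → PathTo x y ↔ ValidWord h (x + y)
paths↔validWords {h} {p} {s} {x} {y} gap = mk↔ₛ′ to from to∘from from∘to
  where
  to : PathTo x y → ValidWord h (x + y)
  to (path π e) = word (pathWord h p s π) (pathWord-valid h p s π (subst (Gap h p s) (sym e) gap))
    (trans (length-pathWord h p s π) (trans (length-endpoint π) (cong (λ (a , b) → a + b) e)))
  from : ValidWord h (x + y) → PathTo x y
  from (word t v l) = path (wordPath h p s t) (wordPath-endpoint h p s t v gap l)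
  to∘from : ∀ w → to (from w) ≡ w
  to∘from (word t v l) = word-cong (recompute (≡-dec _≟ₗ_ _ _) (pathWord-wordPath h p s t v))
  from∘to : ∀ π → from (to π) ≡ π
  from∘to (path π e) = path-cong (wordPath-pathWord h p s π)

stem : ℕ → List Step
stem j = replicate j N ++ E ∷ []

endpoint-stem++ : ∀ j π → endpoint (stem j ++ π) ≡ (suc (proj₁ (endpoint π)) , j + proj₂ (endpoint π))
endpoint-stem++ zero    π = refl
endpoint-stem++ (suc j) π = cong (map₂ suc) (endpoint-stem++ j π)

stem-reaches-0j : ∀ j π → endpoint (take j (stem j ++ π)) ≡ (0 , j)
stem-reaches-0j zero    π = refl
stem-reaches-0j (suc j) π = cong (map₂ suc) (stem-reaches-0j j π)

stem-reaches-1j : ∀ j π → endpoint (take (suc j) (stem j ++ π)) ≡ (1 , j)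
stem-reaches-1j zero    π = refl
stem-reaches-1j (suc j) π = cong (map₂ suc) (stem-reaches-1j j π)

drop-stem++ : ∀ j π → drop (suc j) (stem j ++ π) ≡ π
drop-stem++ zero    π = refl
drop-stem++ (suc j) π = drop-stem++ j π

through⇒stem : ∀ j s {k k′} → endpoint (take k s) ≡ (0 , j) → endpoint (take k′ s) ≡ (1 , j) →
               s ≡ stem j ++ drop (suc j) s
through⇒stem zero    (E ∷ s)                  e₀ e₁ = refl
through⇒stem zero    []      {k′ = zero}      e₀ ()
through⇒stem zero    []      {k′ = suc k′}    e₀ ()
through⇒stem zero    (N ∷ s) {k′ = zero}      e₀ ()
through⇒stem zero    (N ∷ s) {k′ = suc k′}    e₀ ()
through⇒stem (suc j) []      {zero}           () e₁
through⇒stem (suc j) []      {suc k}          () e₁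
through⇒stem (suc j) (E ∷ s) {zero}           () e₁
through⇒stem (suc j) (E ∷ s) {suc k}          () e₁
through⇒stem (suc j) (N ∷ s) {zero}           () e₁
through⇒stem (suc j) (N ∷ s) {suc k} {zero}   e₀ ()
through⇒stem (suc j) (N ∷ s) {suc k} {suc k′} e₀ e₁ =
  cong (N ∷_) (through⇒stem j s {k} {k′} (cong (map₂ pred) e₀) (cong (map₂ pred) e₁))

mkPath-cong : ∀ {a b j s s′} .{e e′ p p′ q q′} → s ≡ s′ → mkPath {a} {b} {j} s e p q ≡ mkPath s′ e′ p′ q′
mkPath-cong refl = refl

through↔paths : ∀ {x y} j → PathThrough (suc x) (j + y) j ↔ PathTo x y
through↔paths {x} {y} j = mk↔ₛ′ to from to∘from from∘to
  where
  split : ∀ {s} → PassesThrough s (0 , j) → PassesThrough s (1 , j) → s ≡ stem j ++ drop (suc j) s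
  split (k , e₀) (k′ , e₁) = through⇒stem j _ e₀ e₁
  ends-after-stem : ∀ {s} → endpoint s ≡ (suc x , j + y) →
                    PassesThrough s (0 , j) → PassesThrough s (1 , j) → endpoint (drop (suc j) s) ≡ (x , y)
  ends-after-stem {s} e t₀ t₁ =
    cong₂ _,_ (suc-injective (cong proj₁ e′)) (+-cancelˡ-≡ j _ _ (cong proj₂ e′))
    where e′ = trans (sym (endpoint-stem++ j (drop (suc j) s))) (trans (cong endpoint (sym (split t₀ t₁))) e)
  to : PathThrough (suc x) (j + y) j → PathTo x y
  to (mkPath s e t₀ t₁) = path (drop (suc j) s) (ends-after-stem e t₀ t₁)
  from : PathTo x y → PathThrough (suc x) (j + y) j
  from (path r e) = mkPath (stem j ++ r) (trans (endpoint-stem++ j r) (cong (λ (a , b) → suc a , j + b) e))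
                           (j , stem-reaches-0j j r) (suc j , stem-reaches-1j j r)
  to∘from : ∀ π → to (from π) ≡ π
  to∘from (path r e) = path-cong (drop-stem++ j r)
  from∘to : ∀ π → from (to π) ≡ π
  from∘to (mkPath s e t₀ t₁) = mkPath-cong (recompute (≡-dec _≟ₛ_ _ _) (sym (split t₀ t₁)))

-- Arc words of 321-avoiding involutions

classify : ℕ → ℕ → Letter
classify v i with <-cmp i v
... | tri< _ _ _ = U
... | tri≈ _ _ _ = F
... | tri> _ _ _ = D

classify-U : ∀ {v i} → i < v → classify v i ≡ U
classify-U {v} {i} i<v with <-cmp i v
... | tri< _ _ _     = refl
... | tri≈ i≮v _ _   = contradiction i<v i≮v
... | tri> i≮v _ _   = contradiction i<v i≮v

classify-F : ∀ {v i} → v ≡ i → classify v i ≡ F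
classify-F {v} {i} v≡i with <-cmp i v
... | tri< _ i≢v _   = contradiction (sym v≡i) i≢v
... | tri≈ _ _ _     = refl
... | tri> _ i≢v _   = contradiction (sym v≡i) i≢v

classify-D : ∀ {v i} → v < i → classify v i ≡ D
classify-D {v} {i} v<i with <-cmp i v
... | tri< _ _ v≮i   = contradiction v<i v≮i
... | tri≈ _ _ v≮i   = contradiction v<i v≮i
... | tri> _ _ _     = refl

classify-U⁻¹ : ∀ {v i} → classify v i ≡ U → i < v
classify-U⁻¹ {v} {i} eq with <-cmp i v
... | tri< i<v _ _ = i<v

classify-F⁻¹ : ∀ {v i} → classify v i ≡ F → v ≡ i
classify-F⁻¹ {v} {i} eq with <-cmp i v
... | tri≈ _ i≡v _ = sym i≡v

classify-D⁻¹ : ∀ {v i} → classify v i ≡ D → v < i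
classify-D⁻¹ {v} {i} eq with <-cmp i v
... | tri> _ _ v<i = v<i

Bounded : (ℕ → ℕ) → ℕ → Set
Bounded σ n = ∀ {i} → i < n → σ i < n

record Is321Involution (σ : ℕ → ℕ) (n : ℕ) : Set where
  field
    bounded    : Bounded σ n
    involutive : ∀ {i} → i < n → σ (σ i) ≡ i
    avoids-321 : ∀ {a b c} → a < b → b < c → c < n → σ c < σ b → σ b < σ a → ⊥

Matched : (ℕ → Letter) → ℕ → ℕ → Set
Matched W i j = W i ≡ U × W j ≡ D × downs W j ≡ ups W i

-- The k-th U is joined to the k-th D.  This first-in-first-out matching makes the arcs
-- non-nesting, which for an involution is the same as avoiding 321.
partnerOf : (ℕ → Letter) → ℕ → ℕ → Letter → ℕ
partnerOf W n i U = find (λ j → (W j ≟ₗ D) ×-dec (downs W j ≟ ups W i)) n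
partnerOf W n i D = find (λ j → (W j ≟ₗ U) ×-dec (ups W j ≟ downs W i)) n
partnerOf W n i F = i

partner : (ℕ → Letter) → ℕ → ℕ → ℕ
partner W n i = partnerOf W n i (W i)

module _ {W : ℕ → Letter} where

  Matched-uniqueʳ : ∀ {i j j′} → Matched W i j → Matched W i j′ → j ≡ j′
  Matched-uniqueʳ (_ , Dj , eq) (_ , Dj′ , eq′) = count-injective (λ k → W k ≟ₗ D) Dj Dj′ (trans eq (sym eq′))

  Matched-uniqueˡ : ∀ {i i′ j} → Matched W i j → Matched W i′ j → i ≡ i′
  Matched-uniqueˡ (Ui , _ , eq) (Ui′ , _ , eq′) = count-injective (λ k → W k ≟ₗ U) Ui Ui′ (trans (sym eq) eq′)

  Matched-monoˡ : ∀ {i i′ j j′} → Matched W i j → Matched W i′ j′ → i < i′ → j < j′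
  Matched-monoˡ (Ui , _ , eq) (_ , _ , eq′) i<i′ =
    count-cancel-< (λ k → W k ≟ₗ D) (subst₂ _<_ (sym eq) (sym eq′) (count-< (λ k → W k ≟ₗ U) i<i′ Ui))

  Matched-monoʳ : ∀ {i i′ j j′} → Matched W i j → Matched W i′ j′ → j < j′ → i < i′
  Matched-monoʳ (_ , Dj , eq) (_ , _ , eq′) j<j′ =
    count-cancel-< (λ k → W k ≟ₗ U) (subst₂ _<_ eq eq′ (count-< (λ k → W k ≟ₗ D) j<j′ Dj))

module _ {W W′ : ℕ → Letter} {n : ℕ} (agree : ∀ {k} → k < n → W k ≡ W′ k) where

  letter-cong : ∀ {k x} → k < n → W k ≡ x → W′ k ≡ x
  letter-cong k<n = trans (sym (agree k<n))

  letter-cong⁻ : ∀ {k x} → k < n → W′ k ≡ x → W k ≡ x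
  letter-cong⁻ k<n = trans (agree k<n)

  count-letter-cong : ∀ x {i} → i ≤ n → count (λ k → W k ≟ₗ x) i ≡ count (λ k → W′ k ≟ₗ x) i
  count-letter-cong x i≤n = count-cong _ _ (λ k<i → letter-cong (<-≤-trans k<i i≤n)) (λ k<i → letter-cong⁻ (<-≤-trans k<i i≤n))

  ValidCounts-cong : ∀ {h} → ValidCounts h W n → ValidCounts h W′ n
  ValidCounts-cong {h} v = record
    { down< = λ i<n D′i → subst₂ _<_ (count-letter-cong D (<⇒≤ i<n)) (cong (h +_) (count-letter-cong U (<⇒≤ i<n)))
                                     (down< v i<n (letter-cong⁻ i<n D′i))
    ; flat≡ = λ i<n F′i → subst₂ _≡_ (cong (h +_) (count-letter-cong U (<⇒≤ i<n))) (count-letter-cong D (<⇒≤ i<n))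
                                     (flat≡ v i<n (letter-cong⁻ i<n F′i))
    ; closed = subst₂ _≡_ (cong (h +_) (count-letter-cong U ≤-refl)) (count-letter-cong D ≤-refl) (closed v)
    }

  partner-cong : ∀ {i} → i < n → partner W n i ≡ partner W′ n i
  partner-cong {i} i<n = trans (cong (partnerOf W n i) (agree i<n)) (by-letter (W′ i))
    where
    by-letter : ∀ x → partnerOf W n i x ≡ partnerOf W′ n i x
    by-letter U = find-cong _ _ {n}
      (λ j<n (Dj , eq) → letter-cong j<n Dj , trans (sym (count-letter-cong D (<⇒≤ j<n))) (trans eq (count-letter-cong U (<⇒≤ i<n))))
      (λ j<n (Dj , eq) → letter-cong⁻ j<n Dj , trans (count-letter-cong D (<⇒≤ j<n)) (trans eq (sym (count-letter-cong U (<⇒≤ i<n)))))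
    by-letter D = find-cong _ _ {n}
      (λ j<n (Uj , eq) → letter-cong j<n Uj , trans (sym (count-letter-cong U (<⇒≤ j<n))) (trans eq (count-letter-cong D (<⇒≤ i<n))))
      (λ j<n (Uj , eq) → letter-cong⁻ j<n Uj , trans (count-letter-cong U (<⇒≤ j<n)) (trans eq (sym (count-letter-cong D (<⇒≤ i<n)))))
    by-letter F = refl

module Decoding {W : ℕ → Letter} {n : ℕ} (valid : ValidCounts 0 W n) where

  downs≤ups : ∀ {i} → i ≤ n → downs W i ≤ ups W i
  downs≤ups {zero}  _   = z≤n
  downs≤ups {suc i} i<n with W i in Wi
  ... | U = m≤n⇒m≤1+n (downs≤ups (<⇒≤ i<n))
  ... | D = down< valid i<n Wi
  ... | F = downs≤ups (<⇒≤ i<n)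

  Matched-< : ∀ {i j} → i < n → Matched W i j → i < j
  Matched-< {i} {j} i<n (Ui , Dj , eq) with <-cmp i j
  ... | tri< i<j _ _ = i<j
  ... | tri≈ _ refl _ = contradiction (trans (sym Ui) Dj) λ ()
  ... | tri> _ _ j<i = contradiction (downs≤ups (<⇒≤ i<n))
                         (<⇒≱ (subst (_< downs W i) eq (count-< (λ k → W k ≟ₗ D) j<i Dj)))

  partner-U : ∀ {i} → i < n → W i ≡ U → Matched W i (partner W n i) × partner W n i < n
  partner-U {i} i<n Ui with count-intermediate (λ k → W k ≟ₗ D) n
                              (subst (ups W i <_) (closed valid) (count-< (λ k → W k ≟ₗ U) i<n Ui))
  ... | j , j<n , Dj , eq = subst (λ k → Matched W i k × k < n) (sym partner≡j) ((Ui , Dj , eq) , j<n)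
    where
    partner≡j : partner W n i ≡ j
    partner≡j = trans (cong (partnerOf W n i) Ui)
      (find-unique _ j<n (Dj , eq) λ (Dj′ , eq′) → Matched-uniqueʳ (Ui , Dj′ , eq′) (Ui , Dj , eq))

  partner-D : ∀ {j} → j < n → W j ≡ D → Matched W (partner W n j) j × partner W n j < j
  partner-D {j} j<n Dj with count-intermediate (λ k → W k ≟ₗ U) j (down< valid j<n Dj)
  ... | i , i<j , Ui , eq = subst (λ k → Matched W k j × k < j) (sym partner≡i) ((Ui , Dj , sym eq) , i<j)
    where
    partner≡i : partner W n j ≡ i
    partner≡i = trans (cong (partnerOf W n j) Dj)
      (find-unique _ (<-trans i<j j<n) (Ui , eq) λ (Ui′ , eq′) → Matched-uniqueˡ (Ui′ , Dj , sym eq′) (Ui , Dj , sym eq))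

  partner-F : ∀ {i} → W i ≡ F → partner W n i ≡ i
  partner-F {i} Fi = cong (partnerOf W n i) Fi

  partner-U-< : ∀ {i} → i < n → W i ≡ U → i < partner W n i
  partner-U-< i<n Ui = Matched-< i<n (proj₁ (partner-U i<n Ui))

  partner-D-< : ∀ {j} → j < n → W j ≡ D → partner W n j < j
  partner-D-< j<n Dj = proj₂ (partner-D j<n Dj)

  partner-before-flat : ∀ {a b} → a < b → b < n → W a ≡ U → W b ≡ F → partner W n a < b
  partner-before-flat {a} {b} a<b b<n Ua Fb = count-cancel-< (λ k → W k ≟ₗ D) (begin-strict
    downs W (partner W n a)     ≡⟨ proj₂ (proj₂ (proj₁ (partner-U (<-trans a<b b<n) Ua))) ⟩
    ups W a                     <⟨ count-< (λ k → W k ≟ₗ U) a<b Ua ⟩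
    ups W b                     ≡⟨ flat≡ valid b<n Fb ⟩
    downs W b                   ∎)
    where open ≤-Reasoning

  partner-bounded : ∀ {i} → i < n → partner W n i < n
  partner-bounded {i} i<n = letter-cases (W i)
    (λ Ui → proj₂ (partner-U i<n Ui))
    (λ Di → <-trans (partner-D-< i<n Di) i<n)
    (λ Fi → subst (_< n) (sym (partner-F Fi)) i<n)

  partner-involutive : ∀ {i} → i < n → partner W n (partner W n i) ≡ i
  partner-involutive {i} i<n = letter-cases (W i)
    (λ Ui → let m , j<n = partner-U i<n Ui in Matched-uniqueˡ (proj₁ (partner-D j<n (proj₁ (proj₂ m)))) m)
    (λ Di → let m , j<i = partner-D i<n Di in Matched-uniqueʳ (proj₁ (partner-U (<-trans j<i i<n) (proj₁ m))) m)
    (λ Fi → trans (partner-F (trans (cong W (partner-F Fi)) Fi)) (partner-F Fi))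

  classify-partner : ∀ {i} → i < n → classify (partner W n i) i ≡ W i
  classify-partner {i} i<n = letter-cases (W i)
    (λ Ui → trans (classify-U (partner-U-< i<n Ui)) (sym Ui))
    (λ Di → trans (classify-D (partner-D-< i<n Di)) (sym Di))
    (λ Fi → trans (classify-F (partner-F Fi)) (sym Fi))

  partner-avoids-321 : ∀ {a b c} → a < b → b < c → c < n →
                       partner W n c < partner W n b → partner W n b < partner W n a → ⊥
  partner-avoids-321 {a} {b} {c} a<b b<c c<n πc<πb πb<πa = letter-cases (W b)
    (λ Ub → <-asym πb<πa (letter-cases (W a)
      (λ Ua → Matched-monoˡ (proj₁ (partner-U a<n Ua)) (proj₁ (partner-U b<n Ub)) a<b)
      (λ Da → <-trans (partner-D-< a<n Da) (<-trans a<b (partner-U-< b<n Ub)))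
      (λ Fa → subst (_< partner W n b) (sym (partner-F Fa)) (<-trans a<b (partner-U-< b<n Ub)))))
    (λ Db → <-asym πc<πb (letter-cases (W c)
      (λ Uc → <-trans (partner-D-< b<n Db) (<-trans b<c (partner-U-< c<n Uc)))
      (λ Dc → Matched-monoʳ (proj₁ (partner-D b<n Db)) (proj₁ (partner-D c<n Dc)) b<c)
      (λ Fc → subst (partner W n b <_) (sym (partner-F Fc)) (<-trans (partner-D-< b<n Db) b<c))))
    (λ Fb → <-asym πb<πa (subst (partner W n a <_) (sym (partner-F Fb)) (letter-cases (W a)
      (λ Ua → partner-before-flat a<b b<n Ua Fb)
      (λ Da → <-trans (partner-D-< a<n Da) a<b)
      (λ Fa → subst (_< b) (sym (partner-F Fa)) a<b))))
    where
    b<n : b < n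
    b<n = <-trans b<c c<n
    a<n : a < n
    a<n = <-trans a<b b<n

  partner-is-321-involution : Is321Involution (partner W n) n
  partner-is-321-involution = record
    { bounded = partner-bounded ; involutive = partner-involutive ; avoids-321 = partner-avoids-321 }

encode : (ℕ → ℕ) → ℕ → Letter
encode σ i = classify (σ i) i

module Encoding {σ : ℕ → ℕ} {n : ℕ} (σ-inv : Is321Involution σ n) where
  open Is321Involution σ-inv

  σ-injective : ∀ {x y} → x < n → y < n → σ x ≡ σ y → x ≡ y
  σ-injective x<n y<n eq = trans (sym (involutive x<n)) (trans (cong σ eq) (involutive y<n))

  count-≤-via-σ : ∀ {p q} {P : ℕ → Set p} {Q : ℕ → Set q} (P? : Decidable P) (Q? : Decidable Q) {m k} →
                  m ≤ n → (∀ {x} → x < m → P x → σ x < k × Q (σ x)) → count P? m ≤ count Q? k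
  count-≤-via-σ P? Q? m≤n into =
    count-≤-injection P? Q? σ into λ x<m y<m _ _ → σ-injective (≤-trans x<m m≤n) (≤-trans y<m m≤n)

  U? : Decidable (λ k → encode σ k ≡ U)
  U? k = encode σ k ≟ₗ U

  D? : Decidable (λ k → encode σ k ≡ D)
  D? k = encode σ k ≟ₗ D

  U⇒σ-D : ∀ {x} → x < n → encode σ x ≡ U → encode σ (σ x) ≡ D
  U⇒σ-D {x} x<n Ux = classify-D (subst (_< σ x) (sym (involutive x<n)) (classify-U⁻¹ Ux))

  D⇒σ-U : ∀ {x} → x < n → encode σ x ≡ D → encode σ (σ x) ≡ U
  D⇒σ-U {x} x<n Dx = classify-U (subst (σ x <_) (sym (involutive x<n)) (classify-D⁻¹ Dx))

  encode-valid : ValidCounts 0 (encode σ) n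
  encode-valid = record { down< = down<′ ; flat≡ = flat≡′ ; closed = closed′ }
    where
    down<′ : ∀ {i} → i < n → encode σ i ≡ D → downs (encode σ) i < ups (encode σ) i
    down<′ {i} i<n Di = ≤-trans (≤-reflexive (sym (count-yes D? Di))) (count-≤-via-σ D? U? i<n into)
      where
      into : ∀ {x} → x < suc i → encode σ x ≡ D → σ x < i × encode σ (σ x) ≡ U
      into x<1+i Dx = <-≤-trans (classify-D⁻¹ Dx) (≤-pred x<1+i) , D⇒σ-U (≤-trans x<1+i i<n) Dx

    flat≡′ : ∀ {i} → i < n → encode σ i ≡ F → ups (encode σ) i ≡ downs (encode σ) i
    flat≡′ {i} i<n Fi = ≤-antisym (count-≤-via-σ U? D? (<⇒≤ i<n) intoD) (count-≤-via-σ D? U? (<⇒≤ i<n) intoU)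
      where
      σi≡i : σ i ≡ i
      σi≡i = classify-F⁻¹ Fi
      intoD : ∀ {x} → x < i → encode σ x ≡ U → σ x < i × encode σ (σ x) ≡ D
      intoD {x} x<i Ux = σx<i , U⇒σ-D x<n Ux
        where
        x<n : x < n
        x<n = <-trans x<i i<n
        σx<i : σ x < i
        σx<i with <-cmp (σ x) i
        ... | tri< σx<i _ _ = σx<i
        ... | tri≈ _ σx≡i _ = contradiction (trans (sym (involutive x<n)) (trans (cong σ σx≡i) σi≡i)) (<⇒≢ x<i)
        ... | tri> _ _ i<σx = ⊥-elim (avoids-321 x<i i<σx (bounded x<n)
                                (subst₂ _<_ (sym (involutive x<n)) (sym σi≡i) x<i) (subst (_< σ x) (sym σi≡i) i<σx))
      intoU : ∀ {x} → x < i → encode σ x ≡ D → σ x < i × encode σ (σ x) ≡ U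
      intoU x<i Dx = <-trans (classify-D⁻¹ Dx) x<i , D⇒σ-U (<-trans x<i i<n) Dx

    closed′ : ups (encode σ) n ≡ downs (encode σ) n
    closed′ = ≤-antisym (count-≤-via-σ U? D? ≤-refl λ x<n Ux → bounded x<n , U⇒σ-D x<n Ux)
                        (count-≤-via-σ D? U? ≤-refl λ x<n Dx → bounded x<n , D⇒σ-U x<n Dx)

  encode-matched : ∀ {i} → i < n → i < σ i → Matched (encode σ) i (σ i)
  encode-matched {i} i<n i<σi = classify-U i<σi , U⇒σ-D i<n (classify-U i<σi) ,
    ≤-antisym (count-≤-via-σ D? U? (<⇒≤ σi<n) intoU) (count-≤-via-σ U? D? (<⇒≤ i<n) intoD)
    where
    σi<n : σ i < n
    σi<n = bounded i<n
    intoU : ∀ {q} → q < σ i → encode σ q ≡ D → σ q < i × encode σ (σ q) ≡ U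
    intoU {q} q<σi Dq = σq<i , D⇒σ-U q<n Dq
      where
      q<n : q < n
      q<n = <-trans q<σi σi<n
      σq<q : σ q < q
      σq<q = classify-D⁻¹ Dq
      σq<i : σ q < i
      σq<i with <-cmp (σ q) i
      ... | tri< σq<i _ _ = σq<i
      ... | tri≈ _ σq≡i _ = contradiction (trans (sym (involutive q<n)) (cong σ σq≡i)) (<⇒≢ q<σi)
      ... | tri> _ _ i<σq = ⊥-elim (avoids-321 (<-trans i<σq σq<q) q<σi σi<n
                              (subst (_< σ q) (sym (involutive i<n)) i<σq) (<-trans σq<q q<σi))
    intoD : ∀ {p} → p < i → encode σ p ≡ U → σ p < σ i × encode σ (σ p) ≡ D
    intoD {p} p<i Up = σp<σi , U⇒σ-D p<n Up
      where
      p<n : p < n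
      p<n = <-trans p<i i<n
      σp<σi : σ p < σ i
      σp<σi with <-cmp (σ p) (σ i)
      ... | tri< σp<σi _ _ = σp<σi
      ... | tri≈ _ σp≡σi _ = contradiction (σ-injective p<n i<n σp≡σi) (<⇒≢ p<i)
      ... | tri> _ _ σi<σp = ⊥-elim (avoids-321 p<i i<σi σi<n (subst (_< σ i) (sym (involutive i<n)) i<σi) σi<σp)

  partner-encode : ∀ {i} → i < n → partner (encode σ) n i ≡ σ i
  partner-encode {i} i<n = by-order (<-cmp i (σ i))
    where
    open Decoding encode-valid
    by-order : Tri (i < σ i) (i ≡ σ i) (σ i < i) → partner (encode σ) n i ≡ σ i
    by-order (tri< i<σi _ _) = Matched-uniqueʳ (proj₁ (partner-U i<n (classify-U i<σi))) (encode-matched i<n i<σi)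
    by-order (tri≈ _ i≡σi _) = trans (partner-F (classify-F (sym i≡σi))) i≡σi
    by-order (tri> _ _ σi<i) = Matched-uniqueˡ (proj₁ (partner-D i<n (classify-D σi<i))) (subst (Matched (encode σ) (σ i))
      (involutive i<n) (encode-matched (bounded i<n) (subst (σ i <_) (sym (involutive i<n)) σi<i)))

leadWord : ℕ → List Letter
leadWord zero    = F ∷ []
leadWord (suc j) = replicate (suc j) U ++ D ∷ []

length-leadWord : ∀ j → length (leadWord j) ≡ suc j
length-leadWord zero    = refl
length-leadWord (suc j) = cong suc (length-U^ j)
  where
  length-U^ : ∀ k → length (replicate k U ++ D ∷ []) ≡ suc k
  length-U^ zero    = refl
  length-U^ (suc k) = cong suc (length-U^ k)

Valid-U^ : ∀ k h t → Valid h (replicate k U ++ t) ≡ Valid (k + h) t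
Valid-U^ zero    h t = refl
Valid-U^ (suc k) h t = trans (Valid-U^ k (suc h) t) (cong (λ h′ → Valid h′ t) (+-suc k h))

Valid-leadWord++ : ∀ j t → Valid 0 (leadWord j ++ t) ≡ Valid (pred j) t
Valid-leadWord++ zero    t = refl
Valid-leadWord++ (suc j) t = begin
  Valid 0 ((replicate (suc j) U ++ D ∷ []) ++ t)   ≡⟨ cong (Valid 0) (++-assoc (replicate (suc j) U) (D ∷ []) t) ⟩
  Valid 0 (replicate (suc j) U ++ D ∷ t)            ≡⟨ Valid-U^ (suc j) 0 (D ∷ t) ⟩
  Valid (j + 0) t                                    ≡⟨ cong (λ h → Valid h t) (+-identityʳ j) ⟩
  Valid j t                                          ∎
  where open ≡-Reasoning

at-U^ : ∀ k t {i} → i < k → at (replicate k U ++ t) i ≡ U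
at-U^ (suc k) t {zero}  _   = refl
at-U^ (suc k) t {suc i} i<k = at-U^ k t (≤-pred i<k)

at-U^-end : ∀ k t → at (replicate k U ++ t) k ≡ at t 0
at-U^-end zero    t = refl
at-U^-end (suc k) t = at-U^-end k t

partner-lead : ∀ j t {n} → Valid 0 (leadWord j ++ t) → length (leadWord j ++ t) ≡ n →
               partner (at (leadWord j ++ t)) n 0 ≡ j
partner-lead zero    t         v len = refl
partner-lead (suc j) t {n} v len =
  Matched-uniqueʳ {i = 0} (proj₁ (partner-U 0<n (at-lead z<s))) (at-lead z<s , at-lead-end , count-none _ {suc j} U≢D)
  where
  w : List Letter
  w = leadWord (suc j) ++ t
  open Decoding (subst (ValidCounts 0 (at w)) len (Valid⇒ValidCounts 0 w v))
  lead<n : suc (suc j) ≤ n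
  lead<n = subst₂ _≤_ (length-leadWord (suc j)) len (length-++-≤ˡ (leadWord (suc j)))
  0<n : 0 < n
  0<n = ≤-trans (s≤s z≤n) lead<n
  at-lead : ∀ {i} → i < suc j → at w i ≡ U
  at-lead {i} i<j = trans (at-++ˡ (leadWord (suc j)) t (subst (i <_) (sym (length-leadWord (suc j))) (m<n⇒m<1+n i<j)))
                      (at-U^ (suc j) (D ∷ []) i<j)
  at-lead-end : at w (suc j) ≡ D
  at-lead-end = trans (at-++ˡ (leadWord (suc j)) t (subst (suc j <_) (sym (length-leadWord (suc j))) ≤-refl))
                      (at-U^-end (suc j) (D ∷ []))
  U≢D : ∀ {k} → k < suc j → at w k ≢ D
  U≢D k<j Dk = contradiction (trans (sym (at-lead k<j)) Dk) λ ()

module _ {σ : ℕ → ℕ} {n : ℕ} (σ-inv : Is321Involution σ n) (0<n : 0 < n) where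
  open Is321Involution σ-inv

  -- Otherwise 0, i and j + 1 would carry a 321 pattern.
  lead-opens : ∀ {j i} → σ 0 ≡ suc j → i < suc j → i < σ i
  lead-opens {j} {zero}  σ0 _   = subst (0 <_) (sym σ0) z<s
  lead-opens {j} {suc i} σ0 i<j with suc i <? σ (suc i)
  ... | yes i<σi = i<σi
  ... | no  i≮σi = ⊥-elim (avoids-321 z<s i<j j<n (subst (_< σ (suc i)) (sym σj≡0) (n≢0⇒n>0 σi≢0))
                                      (≤-<-trans (≮⇒≥ i≮σi) (subst (suc i <_) (sym σ0) i<j)))
    where
    j<n : suc j < n
    j<n = subst (_< n) σ0 (bounded 0<n)
    σj≡0 : σ (suc j) ≡ 0
    σj≡0 = trans (cong σ (sym σ0)) (involutive 0<n)
    σi≢0 : σ (suc i) ≢ 0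
    σi≢0 σi≡0 = <⇒≢ i<j (trans (sym (involutive (<-trans i<j j<n))) (trans (cong σ σi≡0) σ0))

  encode-lead : ∀ {j} → σ 0 ≡ j → ∀ {i} → i < suc j → encode σ i ≡ at (leadWord j) i
  encode-lead {zero}  σ0 {zero}  _         = classify-F σ0
  encode-lead {zero}  σ0 {suc i} (s≤s ())
  encode-lead {suc j} σ0 {i} i<j with m<1+n⇒m<n∨m≡n i<j
  ... | inj₁ i<1+j = trans (classify-U (lead-opens σ0 i<1+j)) (sym (at-U^ (suc j) (D ∷ []) i<1+j))
  ... | inj₂ refl  = trans (classify-D (subst (_< suc j) (sym σj≡0) z<s)) (sym (at-U^-end (suc j) (D ∷ [])))
    where
    σj≡0 : σ (suc j) ≡ 0
    σj≡0 = trans (cong σ (sym σ0)) (involutive 0<n)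

  encode-leadWord : ∀ {j} → σ 0 ≡ j → applyUpTo (encode σ) n ≡ leadWord j ++ drop (suc j) (applyUpTo (encode σ) n)
  encode-leadWord {j} σ0 = subst (λ k → enc ≡ leadWord j ++ drop k enc) (length-leadWord j)
    (++-drop (leadWord j) enc (subst₂ _≤_ (sym (length-leadWord j)) (sym (length-applyUpTo (encode σ) n)) j<n)
      λ {i} i<lead → let i<j = subst (i <_) (length-leadWord j) i<lead in
        trans (at-applyUpTo (encode σ) (<-≤-trans i<j j<n)) (encode-lead σ0 i<j))
    where
    enc : List Letter
    enc = applyUpTo (encode σ) n
    j<n : suc j ≤ n
    j<n = subst (_< n) σ0 (bounded 0<n)

-- Involutions as vectors

module _ {n : ℕ} where

  toFun : Vec (Fin n) n → ℕ → ℕ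
  toFun w i with i <? n
  ... | yes i<n = toℕ (lookup w (fromℕ< i<n))
  ... | no _    = i

  toFun-toℕ : ∀ w k → toFun w (toℕ k) ≡ toℕ (lookup w k)
  toFun-toℕ w k with toℕ k <? n
  ... | yes k<n = cong (toℕ ∘ lookup w) (fromℕ<-toℕ k k<n)
  ... | no  k≮n = contradiction (toℕ<n k) k≮n

  toFun-fromℕ< : ∀ w {i} (i<n : i < n) → toFun w i ≡ toℕ (lookup w (fromℕ< i<n))
  toFun-fromℕ< w i<n = trans (cong (toFun w) (sym (toℕ-fromℕ< i<n))) (toFun-toℕ w _)

  fromFun : (σ : ℕ → ℕ) → .(Bounded σ n) → Vec (Fin n) n
  fromFun σ bounded = tabulate λ k → fromℕ< (bounded (toℕ<n k))

  toℕ-lookup-fromFun : ∀ σ .(b : Bounded σ n) k → toℕ (lookup (fromFun σ b) k) ≡ σ (toℕ k)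
  toℕ-lookup-fromFun σ b k = trans (cong toℕ (lookup∘tabulate _ k)) (toℕ-fromℕ< _)

  toFun-fromFun : ∀ σ .(b : Bounded σ n) {i} → i < n → toFun (fromFun σ b) i ≡ σ i
  toFun-fromFun σ b i<n =
    trans (toFun-fromℕ< _ i<n) (trans (toℕ-lookup-fromFun σ b _) (cong σ (toℕ-fromℕ< i<n)))

  fromFun-unique : ∀ {σ} .(b : Bounded σ n) w → (∀ {i} → i < n → σ i ≡ toFun w i) → fromFun σ b ≡ w
  fromFun-unique b w same = trans (tabulate-cong λ k →
    toℕ-injective (trans (toℕ-fromℕ< _) (trans (same (toℕ<n k)) (toFun-toℕ w k)))) (tabulate∘lookup w)

  toFun-321 : ∀ {w} → IsInvolution w → Avoids321 w → Is321Involution (toFun w) n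
  toFun-321 {w} inv avoid = record
    { bounded    = λ i<n → subst (_< n) (sym (toFun-fromℕ< w i<n)) (toℕ<n _)
    ; involutive = λ i<n → trans (cong (toFun w) (toFun-fromℕ< w i<n))
                             (trans (toFun-toℕ w _) (trans (cong toℕ (inv _)) (toℕ-fromℕ< i<n)))
    ; avoids-321 = λ a<b b<c c<n σc<σb σb<σa →
        let b<n = <-trans b<c c<n ; a<n = <-trans a<b b<n in
        avoid (fromℕ< a<n , fromℕ< b<n , fromℕ< c<n
              , subst₂ _<_ (sym (toℕ-fromℕ< a<n)) (sym (toℕ-fromℕ< b<n)) a<b
              , subst₂ _<_ (sym (toℕ-fromℕ< b<n)) (sym (toℕ-fromℕ< c<n)) b<c
              , subst₂ _<_ (toFun-fromℕ< w c<n) (toFun-fromℕ< w b<n) σc<σb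
              , subst₂ _<_ (toFun-fromℕ< w b<n) (toFun-fromℕ< w a<n) σb<σa)
    }

  fromFun-involution : ∀ {σ} .(b : Bounded σ n) → Is321Involution σ n → IsInvolution (fromFun σ b)
  fromFun-involution {σ} b σ-inv k = toℕ-injective (begin
    toℕ (lookup (fromFun σ b) (lookup (fromFun σ b) k))   ≡⟨ toℕ-lookup-fromFun σ b _ ⟩
    σ (toℕ (lookup (fromFun σ b) k))                      ≡⟨ cong σ (toℕ-lookup-fromFun σ b k) ⟩
    σ (σ (toℕ k))                                          ≡⟨ Is321Involution.involutive σ-inv (toℕ<n k) ⟩
    toℕ k                                                  ∎)
    where open ≡-Reasoning

  fromFun-avoids : ∀ {σ} .(b : Bounded σ n) → Is321Involution σ n → Avoids321 (fromFun σ b)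
  fromFun-avoids {σ} b σ-inv (a , b′ , c , a<b , b<c , σc<σb , σb<σa) =
    Is321Involution.avoids-321 σ-inv a<b b<c (toℕ<n c)
      (subst₂ _<_ (toℕ-lookup-fromFun σ b c) (toℕ-lookup-fromFun σ b b′) σc<σb)
      (subst₂ _<_ (toℕ-lookup-fromFun σ b b′) (toℕ-lookup-fromFun σ b a) σb<σa)

mkInv-cong : ∀ {m l w w′} .{a b c a′ b′ c′} → w ≡ w′ → mkInv {m} {l} w a b c ≡ mkInv w′ a′ b′ c′
mkInv-cong refl = refl

module _ (m j r : ℕ) (j+r≡m : j + r ≡ m) where

  private
    n : ℕ
    n = suc m
  open Is321Involution using (bounded)

  length-leadWord++ : ∀ t → length t ≡ r → length (leadWord j ++ t) ≡ n
  length-leadWord++ t l = trans (length-++ (leadWord j)) (trans (cong₂ _+_ (length-leadWord j) l) (cong suc j+r≡m))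

  decoded-valid : ∀ t → Valid (pred j) t → length t ≡ r → ValidCounts 0 (at (leadWord j ++ t)) n
  decoded-valid t v l = subst (ValidCounts 0 (at (leadWord j ++ t))) (length-leadWord++ t l)
    (Valid⇒ValidCounts 0 (leadWord j ++ t) (subst id (sym (Valid-leadWord++ j t)) v))

  decoded-321 : ∀ t → Valid (pred j) t → length t ≡ r → Is321Involution (partner (at (leadWord j ++ t)) n) n
  decoded-321 t v l = Decoding.partner-is-321-involution (decoded-valid t v l)

  encoded : Vec (Fin n) n → List Letter
  encoded w = drop (suc j) (applyUpTo (encode (toFun w)) n)

  module _ {w : Vec (Fin n) n} (inv : IsInvolution w) (avoid : Avoids321 w) (lead≡ : lead w ≡ suc j) where

    private
      σ-inv : Is321Involution (toFun w) n
      σ-inv = toFun-321 {w = w} inv avoid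
      enc : List Letter
      enc = applyUpTo (encode (toFun w)) n
      σ0≡j : toFun w 0 ≡ j
      σ0≡j = trans (toFun-toℕ w fzero) (suc-injective lead≡)

    enc≡leadWord++ : enc ≡ leadWord j ++ encoded w
    enc≡leadWord++ = encode-leadWord σ-inv z<s σ0≡j

    enc-agrees : ∀ {i} → i < n → encode (toFun w) i ≡ at enc i
    enc-agrees i<n = sym (at-applyUpTo (encode (toFun w)) {n} i<n)

    encoded-valid : Valid (pred j) (encoded w)
    encoded-valid = subst id (Valid-leadWord++ j (encoded w)) (subst (Valid 0) enc≡leadWord++
      (ValidCounts⇒Valid 0 enc (subst (ValidCounts 0 (at enc)) (sym (length-applyUpTo (encode (toFun w)) n))
        (ValidCounts-cong {W = encode (toFun w)} enc-agrees (Encoding.encode-valid σ-inv)))))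

    length-encoded : length (encoded w) ≡ r
    length-encoded = begin
      length (drop (suc j) enc)   ≡⟨ length-drop (suc j) enc ⟩
      length enc ∸ suc j          ≡⟨ cong (_∸ suc j) (length-applyUpTo (encode (toFun w)) n) ⟩
      m ∸ j                       ≡⟨ cong (_∸ j) (sym j+r≡m) ⟩
      (j + r) ∸ j                 ≡⟨ m+n∸m≡n j r ⟩
      r                           ∎
      where open ≡-Reasoning

    partner-encoded : ∀ {i} → i < n → partner (at (leadWord j ++ encoded w)) n i ≡ toFun w i
    partner-encoded {i} i<n = begin
      partner (at (leadWord j ++ encoded w)) n i   ≡⟨ cong (λ e → partner (at e) n i) enc≡leadWord++ ⟨
      partner (at enc) n i                         ≡⟨ partner-cong {W = encode (toFun w)} enc-agrees i<n ⟨
      partner (encode (toFun w)) n i               ≡⟨ Encoding.partner-encode σ-inv i<n ⟩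
      toFun w i                                    ∎
      where open ≡-Reasoning

  encoded-decoded : ∀ t → Valid (pred j) t → length t ≡ r → .(b : Bounded (partner (at (leadWord j ++ t)) n) n) →
                    encoded (fromFun (partner (at (leadWord j ++ t)) n) b) ≡ t
  encoded-decoded t v l b = begin
    drop (suc j) (applyUpTo (encode σ′) n)             ≡⟨ cong (drop (suc j)) (applyUpTo-cong same) ⟩
    drop (suc j) (applyUpTo W n)                       ≡⟨ cong (λ k → drop (suc j) (applyUpTo W k)) (length-leadWord++ t l) ⟨
    drop (suc j) (applyUpTo W (length (leadWord j ++ t))) ≡⟨ cong (drop (suc j)) (applyUpTo-at (leadWord j ++ t)) ⟩
    drop (suc j) (leadWord j ++ t)                     ≡⟨ cong (λ k → drop k (leadWord j ++ t)) (length-leadWord j) ⟨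
    drop (length (leadWord j)) (leadWord j ++ t)       ≡⟨ drop-++ (leadWord j) t ⟩
    t                                                  ∎
    where
    open ≡-Reasoning
    W : ℕ → Letter
    W = at (leadWord j ++ t)
    σ′ : ℕ → ℕ
    σ′ = toFun (fromFun (partner W n) b)
    same : ∀ {i} → i < n → encode σ′ i ≡ W i
    same i<n = trans (cong (λ v → classify v _) (toFun-fromFun _ b i<n)) (Decoding.classify-partner (decoded-valid t v l) i<n)

  words↔involutions : ValidWord (pred j) r ↔ Inv321Lead m (suc j)
  words↔involutions = mk↔ₛ′ to from to∘from from∘to
    where
    to : ValidWord (pred j) r → Inv321Lead m (suc j)
    to (word t v l) = mkInv (fromFun (partner (at (leadWord j ++ t)) n) (bounded (decoded-321 t v l)))
      (fromFun-involution (bounded (decoded-321 t v l)) (decoded-321 t v l))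
      (fromFun-avoids (bounded (decoded-321 t v l)) (decoded-321 t v l))
      (cong suc (trans (toℕ-lookup-fromFun _ (bounded (decoded-321 t v l)) fzero)
                       (partner-lead j t (subst id (sym (Valid-leadWord++ j t)) v) (length-leadWord++ t l))))
    from : Inv321Lead m (suc j) → ValidWord (pred j) r
    from (mkInv w inv avoid lead≡) = word (encoded w) (encoded-valid {w} inv avoid lead≡) (length-encoded {w} inv avoid lead≡)
    to∘from : ∀ x → to (from x) ≡ x
    to∘from (mkInv w inv avoid lead≡) = mkInv-cong (recompute (≡-decᵛ _≟ᶠ_ _ _)
      (fromFun-unique (bounded (decoded-321 (encoded w) (encoded-valid {w} inv avoid lead≡) (length-encoded {w} inv avoid lead≡)))
                      w (partner-encoded {w} inv avoid lead≡)))
    from∘to : ∀ x → from (to x) ≡ x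
    from∘to (word t v l) = word-cong (recompute (≡-dec _≟ₗ_ _ _) (encoded-decoded t v l (bounded (decoded-321 t v l))))

⌈n/2⌉-parity : ∀ n → ⌈ n /2⌉ ≡ ⌊ n /2⌋ ⊎ ⌈ n /2⌉ ≡ suc ⌊ n /2⌋
⌈n/2⌉-parity zero          = inj₁ refl
⌈n/2⌉-parity (suc zero)    = inj₂ refl
⌈n/2⌉-parity (suc (suc n)) = Sum.map (cong suc) (cong suc) (⌈n/2⌉-parity n)

initial-gap : ∀ j {x y} → suc x ≡ j + y ⊎ suc x ≡ suc (j + y) → ∃[ p ] ∃[ s ] Gap (pred j) p s (x , y)
initial-gap zero    (inj₁ e) = true  , false , sym e
initial-gap zero    (inj₂ e) = false , true  , suc-injective e
initial-gap (suc j) {y = y} (inj₁ e) = false , true , trans (suc-injective e) (cong (_+ y) (sym (+-identityʳ j)))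
initial-gap (suc j) {y = y} (inj₂ e) = true  , true , trans (suc-injective e) (cong (_+ y) (+-comm 1 j))

+-rearrange : ∀ j x y → j + y + suc x ≡ suc (j + (x + y))
+-rearrange j x y = begin
  j + y + suc x         ≡⟨ +-suc (j + y) x ⟩
  suc (j + y + x)       ≡⟨ cong suc (+-assoc j y x) ⟩
  suc (j + (y + x))     ≡⟨ cong (suc ∘ (j +_)) (+-comm y x) ⟩
  suc (j + (x + y))     ∎
  where open ≡-Reasoning

lemma4p1 : (m j : ℕ) → j ≤ ⌊ suc m /2⌋ →
    PathThrough ⌈ suc m /2⌉ ⌊ suc m /2⌋ j ↔ Inv321Lead m (suc j)
lemma4p1 m j j≤b = subst (λ b → PathThrough ⌈ suc m /2⌉ b j ↔ Inv321Lead m (suc j)) j+y≡b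
  (↔-trans (through↔paths j)
  (↔-trans (paths↔validWords {p = proj₁ start} {s = proj₁ (proj₂ start)} (proj₂ (proj₂ start)))
           (words↔involutions m j (x + y) (suc-injective length≡))))
  where
  x y : ℕ
  x = ⌊ m /2⌋
  y = ⌊ suc m /2⌋ ∸ j
  j+y≡b : j + y ≡ ⌊ suc m /2⌋
  j+y≡b = m+[n∸m]≡n j≤b
  start : ∃[ p ] ∃[ s ] Gap (pred j) p s (x , y)
  start = initial-gap j (Sum.map (λ e → trans e (sym j+y≡b)) (λ e → trans e (cong suc (sym j+y≡b)))
                                 (⌈n/2⌉-parity (suc m)))
  length≡ : suc (j + (x + y)) ≡ suc m
  length≡ = trans (sym (+-rearrange j x y)) (trans (cong (_+ ⌈ suc m /2⌉) j+y≡b) (⌊n/2⌋+⌈n/2⌉≡n (suc m)))
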